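{- Let $G$ be a properly edge-colored graph on $n$ vertices with minimum degree $\delta$, let $k$ be a positive integer, and let $\mathcal{C}$ be the set of colors used in $G$. If $nk\,\exp\!\left(-\frac{\delta}{8k}\right) < 1$, then there is a partition $\mathcal{C} = \bigsqcup_{i=1}^{k} \mathcal{C}_i$ such that for every vertex $v$ and every $i \in \{1,\dots,k\}$, $v$ is incident to at least $\frac{\delta}{2k}$ edges whose colors lie in $\mathcal{C}_i$.
   Context: An edge-coloring is proper if any two edges sharing a vertex receive distinct colors. -}

module Defs where

open import Data.Nat using (ℕ; zero; suc; _∸_; _≤_) renaming (_+_ to _+ℕ_; _*_ to _*ℕ_)
open import Data.Nat using (_!)
open import Data.Integer using (+_)
open import Data.Rational.Unnormalised.Base using (ℚᵘ; mkℚᵘ; _+_; _*_; _<_; 1ℚᵘ)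
open import Data.Fin using (Fin; zero; suc)
open import Data.Bool using (Bool; true; false; if_then_else_; _∧_)
open import Data.Product using (Σ; ∃; _×_)
open import Relation.Binary.PropositionalEquality using (_≡_; _≢_)
open import Relation.Nullary.Decidable using (⌊_⌋)
import Data.Fin as F

count : ∀ {n} → (Fin n → Bool) → ℕ
count {zero}  p = 0
count {suc n} p = (if p zero then 1 else 0) +ℕ count (λ i → p (suc i))

record SimpleGraph (n : ℕ) : Set where
  field
    adj    : Fin n → Fin n → Bool
    sym    : ∀ u v → adj u v ≡ adj v u
    irrefl : ∀ v → adj v v ≡ false

  degree : Fin n → ℕ
  degree v = count (adj v)

  MinDegree : ℕ → Set
  MinDegree δ = (∀ v → δ ≤ degree v) × ∃ λ v → degree v ≡ δ

-- An edge-colouring with colours in ℕ: col u v is the colour of the edge uv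
-- (values on non-edges are irrelevant).
record ProperEdgeColouring {n : ℕ} (G : SimpleGraph n) : Set where
  open SimpleGraph G
  field
    col    : Fin n → Fin n → ℕ
    colSym : ∀ u v → adj u v ≡ true → col u v ≡ col v u
    proper : ∀ u v w → adj u v ≡ true → adj u w ≡ true → v ≢ w → col u v ≢ col u w

  Used : ℕ → Set
  Used c = ∃ λ u → ∃ λ v → adj u v ≡ true × col u v ≡ c

-- Exponential function on non-negative rationals via its partial sums:
-- expPartial x N = Σ_{j=0}^{N} x^j / j!
powQ : ℚᵘ → ℕ → ℚᵘ
powQ x zero    = 1ℚᵘ
powQ x (suc j) = x * powQ x j

-- 1 / j!   (j! ≥ 1, and mkℚᵘ a b denotes a / (b + 1))
invFact : ℕ → ℚᵘ
invFact j = mkℚᵘ (+ 1) (j ! ∸ 1)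

expPartial : ℚᵘ → ℕ → ℚᵘ
expPartial x zero    = 1ℚᵘ
expPartial x (suc N) = expPartial x N + powQ x (suc N) * invFact (suc N)

-- For x ≥ 0 the partial sums increase to exp x, so for a rational q:
--   q < exp x  ⟺  ∃ N, q < expPartial x N.
LtExp : ℚᵘ → ℚᵘ → Set
LtExp q x = ∃ λ N → q < expPartial x N

-- the rational number a / b for b ≥ 1  (mkℚᵘ a (b ∸ 1) = a / b)
ratℕ : ℕ → ℕ → ℚᵘ
ratℕ a b = mkℚᵘ (+ a) (b ∸ 1)

-- hypothesis  n k exp(-δ/(8k)) < 1,  equivalently  n k < exp(δ/(8k))   (k ≥ 1)
ExpHyp : ℕ → ℕ → ℕ → Set
ExpHyp n k δ = LtExp (ratℕ (n *ℕ k) 1) (ratℕ δ (8 *ℕ k))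

partDegree : ∀ {n k} {G : SimpleGraph n} → ProperEdgeColouring G →
             (ℕ → Fin k) → Fin n → Fin k → ℕ
partDegree {G = G} c part v i =
  count (λ w → SimpleGraph.adj G v w ∧ ⌊ part (ProperEdgeColouring.col c v w) F.≟ i ⌋)

-- The proof is the probabilistic method, carried out by exact counting.
-- Colours are reduced to B classes (B - 1 = largest colour) and all K^B
-- maps f from classes to the K = k parts are counted.  Fix a vertex v and
-- a part i; by properness the d = deg v edges at v lie in distinct classes,
-- so the number of them sent to part i is a sum of d independent
-- indicators.  Weighting each map by 2^(edges missing part i) gives the
-- Chernoff count: at most 2^{⌊δ/2K⌋} (2K-1)^d K^B / (2K)^d maps are bad
-- for (v, i).  Reading the hypothesis through the partial sums of exp gives
-- nK·r^δ < (r+1)^δ for r = 8K - 1, and a binomial estimate turns the two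
-- bounds into  nK · #bad(v, i) < K^B.  The union bound over the nK pairs
-- leaves a map that is bad for no pair; it is the required partition.

module Submission where

open import Defs
open import Data.Nat
open import Data.Nat.Properties
open import Data.Nat.DivMod using (_/_; _mod_; m/n*n≤m; /-monoˡ-≤; m*n/n≡m; m<n⇒m%n≡m)
open import Data.Fin as F using (Fin; zero; suc; toℕ)
import Data.Fin.Properties as FP
open import Data.Bool using (Bool; true; false; if_then_else_; _∧_; not)
open import Data.Product using (Σ; ∃; _×_; _,_; proj₁; proj₂)
open import Data.Sum using (_⊎_; inj₁; inj₂)
open import Data.Vec.Functional using (foldr)
open import Data.Empty using (⊥; ⊥-elim)
open import Function using (_∘_)
open import Relation.Binary.PropositionalEquality
open import Relation.Nullary using (yes; no; ¬_; Dec)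
open import Relation.Nullary.Decidable using (⌊_⌋)
open import Algebra.Properties.CommutativeMonoid.Sum +-0-commutativeMonoid
  using (sum; sum-syntax; sum-cong-≗; ∑-distrib-+; ∑-comm)
open import Algebra.Properties.Semiring.Sum +-*-semiring using (*-distribˡ-sum; *-distribʳ-sum)
open import Data.Nat.Solver using (module +-*-Solver)
open +-*-Solver
open import Data.Rational.Unnormalised.Base as Q using (ℚᵘ; mkℚᵘ; ↥_; ↧ₙ_; *<*)
import Data.Integer as Z
open import Data.Integer.Properties using (pos-*; pos-+; drop‿+<+)

ind : Bool → ℕ
ind b = if b then 1 else 0

ind-∧ : ∀ a b → ind (a ∧ b) ≡ ind a * ind b
ind-∧ true  b = sym (+-identityʳ (ind b))
ind-∧ false b = refl

ind-not : ∀ b → ind (not b) + ind b ≡ 1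
ind-not true  = refl
ind-not false = refl

count-as-sum : ∀ {n} (p : Fin n → Bool) → count p ≡ ∑[ i < n ] ind (p i)
count-as-sum {zero}  p = refl
count-as-sum {suc n} p = cong (ind (p zero) +_) (count-as-sum (p ∘ suc))

∑-const : ∀ n c → ∑[ i < n ] c ≡ n * c
∑-const zero    c = refl
∑-const (suc n) c = cong (c +_) (∑-const n c)

∑-0 : ∀ n → ∑[ i < n ] 0 ≡ 0
∑-0 n = trans (∑-const n 0) (*-zeroʳ n)

∑-mono : ∀ {n} {g h : Fin n → ℕ} → (∀ i → g i ≤ h i) → sum g ≤ sum h
∑-mono {zero}  le = z≤n
∑-mono {suc n} le = +-mono-≤ (le zero) (∑-mono (le ∘ suc))

∑-<-witness : ∀ {n} (g h : Fin n → ℕ) → sum g < sum h → ∃ λ i → g i < h i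
∑-<-witness {suc n} g h lt with g zero <? h zero
... | yes g₀<h₀ = zero , g₀<h₀
... | no  g₀≮h₀ =
  let (i , gᵢ<hᵢ) = ∑-<-witness (g ∘ suc) (h ∘ suc)
                      (+-cancelˡ-< (h zero) _ _ (≤-<-trans (+-monoˡ-≤ _ (≮⇒≥ g₀≮h₀)) lt))
  in suc i , gᵢ<hᵢ

∑≡0⇒≡0 : ∀ {n} (h : Fin n → ℕ) → sum h ≡ 0 → ∀ i → h i ≡ 0
∑≡0⇒≡0 h e zero    = m+n≡0⇒m≡0 (h zero) e
∑≡0⇒≡0 h e (suc i) = ∑≡0⇒≡0 (h ∘ suc) (m+n≡0⇒n≡0 (h zero) e) i

∑-ind-unique : ∀ {n} (p : Fin n → Bool) → (∀ i j → p i ≡ true → p j ≡ true → i ≡ j) →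
               ∑[ i < n ] ind (p i) ≤ 1
∑-ind-unique {zero}  p uniq = z≤n
∑-ind-unique {suc n} p uniq with p zero in p₀
... | true  = ≤-reflexive (cong suc (∑≡0 (λ i → ¬-true (λ pᵢ → FP.0≢1+n (uniq zero (suc i) p₀ pᵢ)))))
  where
  ¬-true : ∀ {b} → (b ≡ true → ⊥) → ind b ≡ 0
  ¬-true {true}  f = ⊥-elim (f refl)
  ¬-true {false} f = refl
  ∑≡0 : ∀ {m} {h : Fin m → ℕ} → (∀ i → h i ≡ 0) → sum h ≡ 0
  ∑≡0 {m} z = trans (sum-cong-≗ z) (∑-0 m)
... | false = ∑-ind-unique (p ∘ suc) (λ i j pᵢ pⱼ → FP.suc-injective (uniq (suc i) (suc j) pᵢ pⱼ))

_≟ᵇ_ : ∀ {n} → Fin n → Fin n → Bool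
x ≟ᵇ y = ⌊ x F.≟ y ⌋

≟ᵇ-true : ∀ {n} {x y : Fin n} → x ≟ᵇ y ≡ true → x ≡ y
≟ᵇ-true {x = x} {y} e with x F.≟ y | e
... | yes x≡y | _ = x≡y

suc-≟ᵇ : ∀ {n} (x y : Fin n) → suc x ≟ᵇ suc y ≡ x ≟ᵇ y
suc-≟ᵇ x y with x F.≟ y
... | yes _ = refl
... | no  _ = refl

∑-point : ∀ {n} (x : Fin n) (h : Fin n → ℕ) → ∑[ c < n ] (ind (x ≟ᵇ c) * h c) ≡ h x
∑-point {suc n} zero h = begin
  h zero + 0 + sum {n} (λ _ → 0)  ≡⟨ cong (h zero + 0 +_) (∑-0 n) ⟩
  h zero + 0 + 0                   ≡⟨ trans (+-identityʳ _) (+-identityʳ _) ⟩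
  h zero                           ∎
  where open ≡-Reasoning
∑-point {suc n} (suc x) h =
  trans (sum-cong-≗ (λ c → cong (λ t → ind t * h (suc c)) (suc-≟ᵇ x c))) (∑-point x (h ∘ suc))

∑-override : ∀ {n} (i : Fin n) a b → ∑[ j < n ] (if j ≟ᵇ i then a else b) + b ≡ a + n * b
∑-override {suc n} zero a b = begin
  a + sum {n} (λ _ → b) + b  ≡⟨ cong (λ t → a + t + b) (∑-const n b) ⟩
  a + n * b + b              ≡⟨ solve 3 (λ a b t → a :+ t :+ b := a :+ (b :+ t)) refl a b (n * b) ⟩
  a + (b + n * b)            ∎
  where open ≡-Reasoning
∑-override {suc n} (suc i) a b = begin
  b + ∑[ j < n ] (if suc j ≟ᵇ suc i then a else b) + b
    ≡⟨ cong (λ t → b + t + b) (sum-cong-≗ (λ j → cong (if_then a else b) (suc-≟ᵇ j i))) ⟩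
  b + ∑[ j < n ] (if j ≟ᵇ i then a else b) + b
    ≡⟨ trans (+-assoc b _ b) (cong (b +_) (∑-override i a b)) ⟩
  b + (a + n * b)
    ≡⟨ solve 3 (λ a b t → b :+ (a :+ t) := a :+ (b :+ t)) refl a b (n * b) ⟩
  a + (b + n * b) ∎
  where open ≡-Reasoning

∏ : ∀ {n} → (Fin n → ℕ) → ℕ
∏ = foldr _*_ 1

∏-pow : ∀ {n} x (e : Fin n → ℕ) → ∏ (λ c → x ^ e c) ≡ x ^ sum e
∏-pow {zero}  x e = refl
∏-pow {suc n} x e =
  trans (cong (x ^ e zero *_) (∏-pow x (e ∘ suc))) (sym (^-distribˡ-+-* x (e zero) _))

-- This is the counting measure that replaces the uniform random
-- assignment of colours to parts.

module MapSum (K : ℕ) where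

  Map : ℕ → Set
  Map B = Fin B → Fin K

  _◂_ : ∀ {B} → Fin K → Map B → Map (suc B)
  (j ◂ f) zero    = j
  (j ◂ f) (suc c) = f c

  ∑map : ∀ B → (Map B → ℕ) → ℕ
  ∑map zero    h = h (λ ())
  ∑map (suc B) h = ∑[ j < K ] ∑map B (λ f → h (j ◂ f))

  ∑map-mono : ∀ B {g h : Map B → ℕ} → (∀ f → g f ≤ h f) → ∑map B g ≤ ∑map B h
  ∑map-mono zero    le = le _
  ∑map-mono (suc B) le = ∑-mono {K} (λ j → ∑map-mono B (λ f → le _))

  ∑map-*ˡ : ∀ B c (h : Map B → ℕ) → ∑map B (λ f → c * h f) ≡ c * ∑map B h
  ∑map-*ˡ zero    c h = refl
  ∑map-*ˡ (suc B) c h =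
    trans (sum-cong-≗ {K} (λ j → ∑map-*ˡ B c _)) (sym (*-distribˡ-sum {K} c _))

  ∑map-1 : ∀ B → ∑map B (λ _ → 1) ≡ K ^ B
  ∑map-1 zero    = refl
  ∑map-1 (suc B) = trans (sum-cong-≗ {K} (λ j → ∑map-1 B)) (∑-const K (K ^ B))

  ∑map-∑ : ∀ B {n} (h : Fin n → Map B → ℕ) →
           ∑map B (λ f → ∑[ v < n ] h v f) ≡ ∑[ v < n ] ∑map B (h v)
  ∑map-∑ zero    h = refl
  ∑map-∑ (suc B) h =
    trans (sum-cong-≗ {K} (λ j → ∑map-∑ B (λ v f → h v (j ◂ f))))
          (∑-comm (λ j v → ∑map B (λ f → h v (j ◂ f))))

  ∑map-<-witness : ∀ B (g h : Map B → ℕ) → ∑map B g < ∑map B h → ∃ λ f → g f < h f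
  ∑map-<-witness zero    g h lt = _ , lt
  ∑map-<-witness (suc B) g h lt =
    let (j , ltⱼ) = ∑-<-witness {K} _ _ lt
        (f , lt′) = ∑map-<-witness B _ _ ltⱼ
    in j ◂ f , lt′

  ∑map-∏ : ∀ B (φ : Fin B → Fin K → ℕ) →
           ∑map B (λ f → ∏ (λ c → φ c (f c))) ≡ ∏ (λ c → ∑[ j < K ] φ c j)
  ∑map-∏ zero    φ = refl
  ∑map-∏ (suc B) φ = begin
    ∑[ j < K ] ∑map B (λ f → φ zero j * ∏ (λ c → φ (suc c) (f c)))
      ≡⟨ sum-cong-≗ {K} (λ j → ∑map-*ˡ B (φ zero j) _) ⟩
    ∑[ j < K ] (φ zero j * ∑map B (λ f → ∏ (λ c → φ (suc c) (f c))))
      ≡⟨ sum-cong-≗ {K} (λ j → cong (φ zero j *_) (∑map-∏ B (φ ∘ suc))) ⟩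
    ∑[ j < K ] (φ zero j * ∏ (λ c → ∑[ j′ < K ] φ (suc c) j′))
      ≡⟨ sym (*-distribʳ-sum {K} _ (φ zero)) ⟩
    ∑[ j < K ] φ zero j * ∏ (λ c → ∑[ j′ < K ] φ (suc c) j′) ∎
    where open ≡-Reasoning

Represents : ℚᵘ → ℕ → ℕ → Set
Represents p a b = (↥ p ≡ Z.+ a) × (↧ₙ p ≡ b)

represents-+ : ∀ p p′ {a b a′ b′} → Represents p a b → Represents p′ a′ b′ →
               Represents (p Q.+ p′) (a * b′ + a′ * b) (b * b′)
represents-+ (mkℚᵘ _ _) (mkℚᵘ _ _) {a} {b} {a′} {b′} (refl , refl) (refl , refl) =
  sym (trans (pos-+ (a * b′) (a′ * b)) (cong₂ Z._+_ (pos-* a b′) (pos-* a′ b))) , refl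

represents-* : ∀ p p′ {a b a′ b′} → Represents p a b → Represents p′ a′ b′ →
               Represents (p Q.* p′) (a * a′) (b * b′)
represents-* (mkℚᵘ _ _) (mkℚᵘ _ _) {a} {_} {a′} (refl , refl) (refl , refl) =
  sym (pos-* a a′) , refl

represents-pow : ∀ x {a b} → Represents x a b → ∀ j → Represents (powQ x j) (a ^ j) (b ^ j)
represents-pow x rep zero    = refl , refl
represents-pow x rep (suc j) = represents-* x (powQ x j) rep (represents-pow x rep j)

represents-invFact : ∀ j → Represents (invFact j) 1 (j !)
represents-invFact j = refl , m+[n∸m]≡n (1≤n! j)

represents-< : ∀ p {m a b} → Represents p a b → mkℚᵘ (Z.+ m) 0 Q.< p → m * b < a
represents-< (mkℚᵘ _ _) {m} {a} {b} (refl , refl) (*<* lt) =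
  subst (m * b <_) (*-identityʳ a)
    (drop‿+<+ (subst₂ Z._<_ (sym (pos-* m b)) (sym (pos-* a 1)) lt))

-- Write q = r + 1.  Every partial sum of exp(δ/q) is at most (q/r)^δ — in
-- effect exp(1/q) ≤ 1/(1 - 1/q) — so  m < exp(δ/q)  forces  m·r^δ < q^δ.
-- All quantities are kept in ℕ by clearing the denominator N!·q^N of the
-- N-th partial sum.

pow-suc-gap : ∀ x p → suc x ^ suc p ≤ x ^ suc p + suc p * suc x ^ p
pow-suc-gap x zero    = ≤-reflexive (solve 1 (λ x → (con 1 :+ x) :* con 1 := x :* con 1 :+ con 1 :* con 1) refl x)
pow-suc-gap x (suc p) = begin
  suc x * suc x ^ suc p
    ≤⟨ *-monoʳ-≤ (suc x) (pow-suc-gap x p) ⟩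
  suc x * (x ^ suc p + suc p * suc x ^ p)
    ≡⟨ solve 4 (λ x p a b → (con 1 :+ x) :* (a :+ (con 1 :+ p) :* b)
                         := x :* a :+ a :+ (con 1 :+ p) :* ((con 1 :+ x) :* b)) refl x p (x ^ suc p) (suc x ^ p) ⟩
  x * x ^ suc p + x ^ suc p + suc p * (suc x * suc x ^ p)
    ≤⟨ +-monoˡ-≤ _ (+-monoʳ-≤ (x * x ^ suc p) (^-monoˡ-≤ (suc p) (n≤1+n x))) ⟩
  x * x ^ suc p + suc x ^ suc p + suc p * suc x ^ suc p
    ≡⟨ +-assoc (x * x ^ suc p) _ _ ⟩
  x * x ^ suc p + suc (suc p) * suc x ^ suc p ∎
  where open ≤-Reasoning

module ExpBound (r : ℕ) where
  q : ℕ
  q = suc r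

  -- cleared δ N = N!·q^N · Σ_{j≤N} δ^j / (j!·q^j)
  cleared : ℕ → ℕ → ℕ
  cleared δ zero    = 1
  cleared δ (suc N) = suc N * q * cleared δ N + δ ^ suc N

  cleared-zero : ∀ N → cleared 0 N ≡ N ! * q ^ N
  cleared-zero zero    = refl
  cleared-zero (suc N) =
    trans (cong (λ t → suc N * q * t + 0) (cleared-zero N))
      (solve 4 (λ N q F A → (con 1 :+ N) :* q :* (F :* A) :+ con 0 := (con 1 :+ N) :* F :* (q :* A))
             refl N q (N !) (q ^ N))

  -- increasing δ by one: a Pascal-type recursion, from pow-suc-gap termwise
  cleared-suc : ∀ δ N → cleared (suc δ) (suc N) ≤ cleared δ (suc N) + suc N * cleared (suc δ) N
  cleared-suc δ zero = ≤-reflexive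
    (solve 2 (λ r d → con 1 :* (con 1 :+ r) :* con 1 :+ (con 1 :+ d) :* con 1
                   := con 1 :* (con 1 :+ r) :* con 1 :+ d :* con 1 :+ con 1 :* con 1) refl r δ)
  cleared-suc δ (suc N) = begin
    suc (suc N) * q * cleared (suc δ) (suc N) + suc δ ^ suc (suc N)
      ≤⟨ +-mono-≤ (*-monoʳ-≤ (suc (suc N) * q) (cleared-suc δ N)) (pow-suc-gap δ (suc N)) ⟩
    suc (suc N) * q * (cleared δ (suc N) + suc N * cleared (suc δ) N) + (δ ^ suc (suc N) + suc (suc N) * suc δ ^ suc N)
      ≡⟨ solve 6 (λ N q u v a b → (con 2 :+ N) :* q :* (u :+ (con 1 :+ N) :* v) :+ (a :+ (con 2 :+ N) :* b)
                  := (con 2 :+ N) :* q :* u :+ a :+ (con 2 :+ N) :* ((con 1 :+ N) :* q :* v :+ b))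
                 refl N q (cleared δ (suc N)) (cleared (suc δ) N) (δ ^ suc (suc N)) (suc δ ^ suc N) ⟩
    cleared δ (suc (suc N)) + suc (suc N) * cleared (suc δ) (suc N) ∎
    where open ≤-Reasoning

  cleared-bound : ∀ δ N → r ^ δ * cleared δ N ≤ N ! * q ^ N * q ^ δ
  cleared-bound zero N = ≤-reflexive
    (trans (cong (1 *_) (cleared-zero N)) (solve 2 (λ F A → con 1 :* (F :* A) := F :* A :* con 1) refl (N !) (q ^ N)))
  cleared-bound (suc δ) zero = begin
    r ^ suc δ * 1  ≡⟨ *-identityʳ _ ⟩
    r ^ suc δ      ≤⟨ ^-monoˡ-≤ (suc δ) (n≤1+n r) ⟩
    q ^ suc δ      ≡⟨ sym (*-identityˡ _) ⟩
    1 * 1 * q ^ suc δ ∎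
    where open ≤-Reasoning
  cleared-bound (suc δ) (suc N) = begin
    r * r ^ δ * cleared (suc δ) (suc N)
      ≤⟨ *-monoʳ-≤ (r * r ^ δ) (cleared-suc δ N) ⟩
    r * r ^ δ * (cleared δ (suc N) + suc N * cleared (suc δ) N)
      ≡⟨ solve 5 (λ r R u N v → r :* R :* (u :+ (con 1 :+ N) :* v) := r :* (R :* u) :+ (con 1 :+ N) :* (r :* R :* v))
                 refl r (r ^ δ) (cleared δ (suc N)) N (cleared (suc δ) N) ⟩
    r * (r ^ δ * cleared δ (suc N)) + suc N * (r ^ suc δ * cleared (suc δ) N)
      ≤⟨ +-mono-≤ (*-monoʳ-≤ r (cleared-bound δ (suc N))) (*-monoʳ-≤ (suc N) (cleared-bound (suc δ) N)) ⟩
    r * (suc N ! * q ^ suc N * q ^ δ) + suc N * (N ! * q ^ N * q ^ suc δ)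
      ≡⟨ solve 5 (λ r N F A B → r :* ((con 1 :+ N) :* F :* ((con 1 :+ r) :* A) :* B) :+ (con 1 :+ N) :* (F :* A :* ((con 1 :+ r) :* B))
                  := (con 1 :+ N) :* F :* ((con 1 :+ r) :* A) :* ((con 1 :+ r) :* B))
                 refl r N (N !) (q ^ N) (q ^ δ) ⟩
    suc N ! * q ^ suc N * q ^ suc δ ∎
    where open ≤-Reasoning

  expPartial-cleared : ∀ δ N → ∃ λ a → ∃ λ b →
                       Represents (expPartial (ratℕ δ q) N) a b × a * (N ! * q ^ N) ≡ cleared δ N * b
  expPartial-cleared δ zero = 1 , 1 , (refl , refl) , refl
  expPartial-cleared δ (suc N) =
    let (a , b , rep , eq) = expPartial-cleared δ N
        x = ratℕ δ q
        term = represents-* (powQ x (suc N)) (invFact (suc N))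
                 (represents-pow x (refl , refl) (suc N)) (represents-invFact (suc N))
    in _ , _ , represents-+ (expPartial x N) _ rep term , step a b eq
    where
    step : ∀ a b → a * (N ! * q ^ N) ≡ cleared δ N * b →
           (a * (q ^ suc N * suc N !) + δ ^ suc N * 1 * b) * (suc N ! * q ^ suc N)
             ≡ cleared δ (suc N) * (b * (q ^ suc N * suc N !))
    step a b eq = begin
      (a * (q ^ suc N * suc N !) + δ ^ suc N * 1 * b) * (suc N ! * q ^ suc N)
        ≡⟨ solve 7 (λ a b N q F A P → (a :* (q :* A :* ((con 1 :+ N) :* F)) :+ P :* con 1 :* b) :* ((con 1 :+ N) :* F :* (q :* A))
                    := (a :* (F :* A)) :* ((con 1 :+ N) :* q :* (q :* A :* ((con 1 :+ N) :* F))) :+ P :* b :* (q :* A :* ((con 1 :+ N) :* F)))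
                   refl a b N q (N !) (q ^ N) (δ ^ suc N) ⟩
      a * (N ! * q ^ N) * (suc N * q * (q ^ suc N * suc N !)) + δ ^ suc N * b * (q ^ suc N * suc N !)
        ≡⟨ cong (λ t → t * (suc N * q * (q ^ suc N * suc N !)) + δ ^ suc N * b * (q ^ suc N * suc N !)) eq ⟩
      cleared δ N * b * (suc N * q * (q ^ suc N * suc N !)) + δ ^ suc N * b * (q ^ suc N * suc N !)
        ≡⟨ solve 6 (λ b N q S P U → U :* b :* ((con 1 :+ N) :* q :* S) :+ P :* b :* S
                    := ((con 1 :+ N) :* q :* U :+ P) :* (b :* S))
                   refl b N q (q ^ suc N * suc N !) (δ ^ suc N) (cleared δ N) ⟩
      cleared δ (suc N) * (b * (q ^ suc N * suc N !)) ∎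
      where open ≡-Reasoning

exp-bound : ∀ r δ m → 0 < r → LtExp (ratℕ m 1) (ratℕ δ (suc r)) → m * r ^ δ < suc r ^ δ
exp-bound r δ m r>0 (N , m<partial) =
  let (a , b , rep , eq) = expPartial-cleared δ N in
  *-cancelˡ-< F (m * r ^ δ) (suc r ^ δ) (chain a b rep eq)
  where
  open ExpBound r
  F : ℕ
  F = N ! * q ^ N
  instance
    F≢0 : NonZero F
    F≢0 = m*n≢0 (N !) (q ^ N) {{N !≢0}} {{m^n≢0 q N}}
    rᵟ≢0 : NonZero (r ^ δ)
    rᵟ≢0 = m^n≢0 r δ {{>-nonZero r>0}}
  chain : ∀ a b → Represents (expPartial (ratℕ δ q) N) a b → a * F ≡ cleared δ N * b →
          F * (m * r ^ δ) < F * q ^ δ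
  chain a b rep eq = begin-strict
    F * (m * r ^ δ)        ≡⟨ solve 3 (λ F m R → F :* (m :* R) := m :* F :* R) refl F m (r ^ δ) ⟩
    m * F * r ^ δ          <⟨ *-monoˡ-< (r ^ δ) mF<cleared ⟩
    cleared δ N * r ^ δ    ≡⟨ *-comm (cleared δ N) (r ^ δ) ⟩
    r ^ δ * cleared δ N    ≤⟨ cleared-bound δ N ⟩
    F * q ^ δ ∎
    where
    open ≤-Reasoning
    instance
      b≢0 : NonZero b
      b≢0 = subst NonZero (proj₂ rep) _
    mF<cleared : m * F < cleared δ N
    mF<cleared = *-cancelʳ-< b (m * F) (cleared δ N)
      (subst₂ _<_ (solve 3 (λ m b F → m :* b :* F := m :* F :* b) refl m b F) eq
        (*-monoˡ-< F (represents-< (expPartial (ratℕ δ q) N) rep m<partial)))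

^-distribʳ-* : ∀ x y e → (x * y) ^ e ≡ x ^ e * y ^ e
^-distribʳ-* x y zero    = refl
^-distribʳ-* x y (suc e) =
  trans (cong ((x * y) *_) (^-distribʳ-* x y e))
    (solve 4 (λ x y a b → (x :* y) :* (a :* b) := (x :* a) :* (y :* b)) refl x y (x ^ e) (y ^ e))

^-comm : ∀ x a b → (x ^ a) ^ b ≡ (x ^ b) ^ a
^-comm x a b = trans (^-*-assoc x a b) (trans (cong (x ^_) (*-comm a b)) (sym (^-*-assoc x b a)))

^-reflects-< : ∀ e {a b} → a ^ e < b ^ e → a < b
^-reflects-< e {a} {b} lt with a <? b
... | yes a<b = a<b
... | no  a≮b = ⊥-elim (<⇒≱ lt (^-monoˡ-≤ e (≮⇒≥ a≮b)))

pairs : ℕ → ℕ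
pairs zero    = 0
pairs (suc p) = pairs p + p + p

pairs-suc : ∀ p → pairs (suc p) ≡ suc p * p
pairs-suc zero    = refl
pairs-suc (suc p) = trans (cong (λ t → t + suc p + suc p) (pairs-suc p))
  (solve 1 (λ p → (con 1 :+ p) :* p :+ (con 1 :+ p) :+ (con 1 :+ p) := (con 2 :+ p) :* (con 1 :+ p)) refl p)

-- 2D² · (1 + c/D)^p ≥ 2D² + 2cpD + c²p(p-1), i.e. the binomial expansion
-- of (D + c)^p truncated after its quadratic term, with denominators cleared
binomial-quadratic : ∀ D c p →
  D ^ p * (2 * D * D + 2 * c * p * D + c * c * pairs p) ≤ (D + c) ^ p * (2 * D * D)
binomial-quadratic D c zero = ≤-reflexive
  (cong (λ t → 1 * t) (solve 2 (λ D c → con 2 :* D :* D :+ con 2 :* c :* con 0 :* D :+ c :* c :* con 0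
                                   := con 2 :* D :* D) refl D c))
binomial-quadratic D c (suc p) = begin
  D * D ^ p * Q (suc p)        ≡⟨ solve 3 (λ D a b → D :* a :* b := a :* (D :* b)) refl D (D ^ p) (Q (suc p)) ⟩
  D ^ p * (D * Q (suc p))      ≤⟨ *-monoʳ-≤ (D ^ p) (m≤m+n (D * Q (suc p)) (c * c * c * pairs p)) ⟩
  D ^ p * (D * Q (suc p) + c * c * c * pairs p)
                               ≡⟨ cong (D ^ p *_) step ⟩
  D ^ p * ((D + c) * Q p)      ≡⟨ solve 3 (λ a b x → a :* (b :* x) := b :* (a :* x)) refl (D ^ p) (D + c) (Q p) ⟩
  (D + c) * (D ^ p * Q p)      ≤⟨ *-monoʳ-≤ (D + c) (binomial-quadratic D c p) ⟩
  (D + c) * ((D + c) ^ p * (2 * D * D))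
                               ≡⟨ sym (*-assoc (D + c) _ _) ⟩
  (D + c) * (D + c) ^ p * (2 * D * D) ∎
  where
  open ≤-Reasoning
  Q : ℕ → ℕ
  Q p = 2 * D * D + 2 * c * p * D + c * c * pairs p
  step : D * Q (suc p) + c * c * c * pairs p ≡ (D + c) * Q p
  step = solve 4 (λ D c p t → D :* (con 2 :* D :* D :+ con 2 :* c :* (con 1 :+ p) :* D :+ c :* c :* (t :+ p :+ p))
                                :+ c :* c :* c :* t
                           := (D :+ c) :* (con 2 :* D :* D :+ con 2 :* c :* p :* D :+ c :* c :* t))
                 refl D c p (pairs p)

two-≤-pow : ∀ k → 2 * (8 * k + 4) ^ (2 * k + 2) ≤ (8 * k + 7) ^ (2 * k + 2)
two-≤-pow k = *-cancelʳ-≤ _ _ (2 * D * D) {{2D²≢0}} (begin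
  2 * D ^ m * (2 * D * D)
    ≡⟨ solve 3 (λ a b c → con 2 :* a :* b := a :* (con 2 :* b)) refl (D ^ m) (2 * D * D) D ⟩
  D ^ m * (2 * (2 * D * D))
    ≤⟨ *-monoʳ-≤ (D ^ m) (m≤m+n _ (4 * k * k + 70 * k + 34)) ⟩
  D ^ m * (2 * (2 * D * D) + (4 * k * k + 70 * k + 34))
    ≡⟨ cong (D ^ m *_) (sym quadratic-terms) ⟩
  D ^ m * (2 * D * D + 2 * 3 * m * D + 3 * 3 * pairs m)
    ≤⟨ binomial-quadratic D 3 m ⟩
  (D + 3) ^ m * (2 * D * D)
    ≡⟨ cong (λ t → t ^ m * (2 * D * D)) (+-assoc (8 * k) 4 3) ⟩
  (8 * k + 7) ^ m * (2 * D * D) ∎)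
  where
  open ≤-Reasoning
  D m : ℕ
  D = 8 * k + 4
  m = 2 * k + 2
  2D²≢0 : NonZero (2 * D * D)
  2D²≢0 = m*n≢0 (2 * D) D {{m*n≢0 2 D {{_}} {{D≢0}}}} {{D≢0}}
    where D≢0 : NonZero D
          D≢0 = subst NonZero (+-comm 4 (8 * k)) _
  pairs-m : pairs m ≡ m * (2 * k + 1)
  pairs-m = trans (cong pairs (+-comm (2 * k) 2)) (trans (pairs-suc (suc (2 * k)))
              (cong₂ _*_ (+-comm 2 (2 * k)) (+-comm 1 (2 * k))))
  quadratic-terms : 2 * D * D + 2 * 3 * m * D + 3 * 3 * pairs m ≡ 2 * (2 * D * D) + (4 * k * k + 70 * k + 34)
  quadratic-terms = trans (cong (λ t → 2 * D * D + 2 * 3 * m * D + 3 * 3 * t) pairs-m)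
    (solve 1 (λ k → con 2 :* (con 8 :* k :+ con 4) :* (con 8 :* k :+ con 4)
                      :+ con 2 :* con 3 :* (con 2 :* k :+ con 2) :* (con 8 :* k :+ con 4)
                      :+ con 3 :* con 3 :* ((con 2 :* k :+ con 2) :* (con 2 :* k :+ con 1))
                 := con 2 :* (con 2 :* (con 8 :* k :+ con 4) :* (con 8 :* k :+ con 4)) :+ (con 4 :* k :* k :+ con 70 :* k :+ con 34))
           refl k)

-- For k = K and a vertex of degree d ≥ δ, the
-- Chernoff count below bounds the proportion of bad maps by
-- 2^{a} ((2K-1)/(2K))^d with a·2K ≤ δ; here we show that this is less
-- than 1/(nK) whenever nK·r^δ < (r+1)^δ with r = 8K - 1.  To avoid
-- roots everything is raised to the power m = 2K.

module TailEstimate (k : ℕ) where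
  K m u r U V : ℕ
  K = suc k
  m = 2 * K
  u = 2 * k + 1
  r = 8 * k + 7
  U = u ^ m
  V = (2 * K) ^ m

  instance
    u≢0 : NonZero u
    u≢0 = subst NonZero (+-comm 1 (2 * k)) _
    U≢0 : NonZero U
    U≢0 = m^n≢0 u m
    rᵐ≢0 : NonZero (r ^ m)
    rᵐ≢0 = m^n≢0 r m {{subst NonZero (+-comm 7 (8 * k)) _}}

  -- 2 ((2K-1)/2K)^{2K} ≤ ((8K-1)/8K)^{2K}, using (2K-1)·8K = 2K·(8K-4)
  per-unit : 2 * U * suc r ^ m ≤ V * r ^ m
  per-unit = begin
    2 * U * suc r ^ m          ≡⟨ trans (*-assoc 2 U _) (cong (2 *_) (sym (^-distribʳ-* u (suc r) m))) ⟩
    2 * (u * suc r) ^ m        ≡⟨ cong (λ t → 2 * t ^ m) factor ⟩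
    2 * (2 * K * D) ^ m        ≡⟨ cong (2 *_) (^-distribʳ-* (2 * K) D m) ⟩
    2 * (V * D ^ m)            ≡⟨ solve 2 (λ a b → con 2 :* (a :* b) := a :* (con 2 :* b)) refl V (D ^ m) ⟩
    V * (2 * D ^ m)            ≤⟨ *-monoʳ-≤ V (subst (λ e → 2 * D ^ e ≤ r ^ e) m≡ (two-≤-pow k)) ⟩
    V * r ^ m ∎
    where
    open ≤-Reasoning
    D : ℕ
    D = 8 * k + 4
    factor : u * suc r ≡ 2 * K * D
    factor = solve 1 (λ k → (con 2 :* k :+ con 1) :* (con 1 :+ (con 8 :* k :+ con 7))
                          := con 2 :* (con 1 :+ k) :* (con 8 :* k :+ con 4)) refl k
    m≡ : 2 * k + 2 ≡ m
    m≡ = solve 1 (λ k → con 2 :* k :+ con 2 := con 2 :* (con 1 :+ k)) refl k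

  U≤V : U ≤ V
  U≤V = ^-monoˡ-≤ m (subst (u ≤_) (solve 1 (λ k → con 2 :* k :+ con 1 :+ con 1 := con 2 :* (con 1 :+ k)) refl k)
                                 (m≤m+n u 1))

  tail : ∀ N δ d → N * r ^ δ < suc r ^ δ → δ ≤ d → N ^ m * 2 ^ δ * U ^ d < V ^ d
  tail N δ d hyp δ≤d = *-cancelʳ-< R (N ^ m * 2 ^ δ * U ^ d) (V ^ d) (begin-strict
    N ^ m * 2 ^ δ * U ^ d * R
      ≡⟨ cong (λ t → N ^ m * 2 ^ δ * t * R) (trans (cong (U ^_) (sym d≡)) (^-distribˡ-+-* U δ e)) ⟩
    N ^ m * 2 ^ δ * (U ^ δ * U ^ e) * R
      ≡⟨ solve 5 (λ N T A B R → N :* T :* (A :* B) :* R := (N :* R) :* (T :* A :* B)) refl (N ^ m) (2 ^ δ) (U ^ δ) (U ^ e) R ⟩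
    N ^ m * R * (2 ^ δ * U ^ δ * U ^ e)
      <⟨ *-monoˡ-< (2 ^ δ * U ^ δ * U ^ e) {{2ᵟUᵈ≢0}} hypᵐ ⟩
    (suc r ^ m) ^ δ * (2 ^ δ * U ^ δ * U ^ e)
      ≡⟨ solve 4 (λ Q T A B → Q :* (T :* A :* B) := T :* A :* Q :* B) refl ((suc r ^ m) ^ δ) (2 ^ δ) (U ^ δ) (U ^ e) ⟩
    2 ^ δ * U ^ δ * (suc r ^ m) ^ δ * U ^ e
      ≡⟨ cong (_* U ^ e) (trans (cong (_* (suc r ^ m) ^ δ) (sym (^-distribʳ-* 2 U δ))) (sym (^-distribʳ-* (2 * U) (suc r ^ m) δ))) ⟩
    (2 * U * suc r ^ m) ^ δ * U ^ e
      ≤⟨ *-mono-≤ (^-monoˡ-≤ δ per-unit) (^-monoˡ-≤ e U≤V) ⟩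
    (V * r ^ m) ^ δ * V ^ e
      ≡⟨ cong (_* V ^ e) (^-distribʳ-* V (r ^ m) δ) ⟩
    V ^ δ * R * V ^ e
      ≡⟨ solve 3 (λ A R B → A :* R :* B := A :* B :* R) refl (V ^ δ) R (V ^ e) ⟩
    V ^ δ * V ^ e * R
      ≡⟨ cong (_* R) (trans (sym (^-distribˡ-+-* V δ e)) (cong (V ^_) d≡)) ⟩
    V ^ d * R ∎)
    where
    open ≤-Reasoning
    e : ℕ
    e = d ∸ δ
    d≡ : δ + e ≡ d
    d≡ = m+[n∸m]≡n δ≤d
    R : ℕ
    R = (r ^ m) ^ δ
    instance
      R≢0 : NonZero R
      R≢0 = m^n≢0 (r ^ m) δ
    2ᵟUᵈ≢0 : NonZero (2 ^ δ * U ^ δ * U ^ e)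
    2ᵟUᵈ≢0 = m*n≢0 (2 ^ δ * U ^ δ) (U ^ e) {{m*n≢0 (2 ^ δ) (U ^ δ) {{m^n≢0 2 δ}} {{m^n≢0 U δ}}}} {{m^n≢0 U e}}
    hypᵐ : N ^ m * R < (suc r ^ m) ^ δ
    hypᵐ = subst₂ _<_ (trans (^-distribʳ-* N (r ^ δ) m) (cong (N ^ m *_) (^-comm r δ m)))
                      (^-comm (suc r) δ m) (^-monoˡ-< m hyp)

  few-bad-maps : ∀ n δ d a B bad → n * K * r ^ δ < suc r ^ δ →
                 bad * (2 ^ d * K ^ d) ≤ 2 ^ a * (u ^ d * K ^ B) → a * m ≤ δ → δ ≤ d →
                 n * K * bad < K ^ B
  few-bad-maps n δ d a B bad hyp count a·m≤δ δ≤d =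
    ^-reflects-< m (*-cancelʳ-< (V ^ d) (L ^ m) ((K ^ B) ^ m) (begin-strict
      L ^ m * V ^ d
        ≡⟨ cong₂ _*_ (^-distribʳ-* (n * K) bad m) (^-comm (2 * K) m d) ⟩
      N ^ m * bad ^ m * ((2 * K) ^ d) ^ m
        ≡⟨ trans (*-assoc (N ^ m) _ _) (cong (N ^ m *_) (sym (^-distribʳ-* bad ((2 * K) ^ d) m))) ⟩
      N ^ m * (bad * (2 * K) ^ d) ^ m
        ≡⟨ cong (λ t → N ^ m * (bad * t) ^ m) (^-distribʳ-* 2 K d) ⟩
      N ^ m * (bad * (2 ^ d * K ^ d)) ^ m
        ≤⟨ *-monoʳ-≤ (N ^ m) (^-monoˡ-≤ m count) ⟩
      N ^ m * (2 ^ a * (u ^ d * K ^ B)) ^ m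
        ≡⟨ cong (N ^ m *_) powers ⟩
      N ^ m * (2 ^ (a * m) * (U ^ d * (K ^ B) ^ m))
        ≤⟨ *-monoʳ-≤ (N ^ m) (*-monoˡ-≤ (U ^ d * (K ^ B) ^ m) (^-monoʳ-≤ 2 a·m≤δ)) ⟩
      N ^ m * (2 ^ δ * (U ^ d * (K ^ B) ^ m))
        ≡⟨ solve 4 (λ N T A B → N :* (T :* (A :* B)) := N :* T :* A :* B) refl (N ^ m) (2 ^ δ) (U ^ d) ((K ^ B) ^ m) ⟩
      N ^ m * 2 ^ δ * U ^ d * (K ^ B) ^ m
        <⟨ *-monoˡ-< ((K ^ B) ^ m) {{m^n≢0 (K ^ B) m {{m^n≢0 K B}}}} (tail N δ d hyp δ≤d) ⟩
      V ^ d * (K ^ B) ^ m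
        ≡⟨ *-comm (V ^ d) _ ⟩
      (K ^ B) ^ m * V ^ d ∎))
    where
    open ≤-Reasoning
    N L : ℕ
    N = n * K
    L = N * bad
    instance
      Vᵈ≢0 : NonZero (V ^ d)
      Vᵈ≢0 = m^n≢0 V d {{m^n≢0 (2 * K) m}}
    powers : (2 ^ a * (u ^ d * K ^ B)) ^ m ≡ 2 ^ (a * m) * (U ^ d * (K ^ B) ^ m)
    powers = begin-equality
      (2 ^ a * (u ^ d * K ^ B)) ^ m         ≡⟨ ^-distribʳ-* (2 ^ a) _ m ⟩
      (2 ^ a) ^ m * (u ^ d * K ^ B) ^ m       ≡⟨ cong₂ _*_ (^-*-assoc 2 a m) (^-distribʳ-* (u ^ d) (K ^ B) m) ⟩
      2 ^ (a * m) * ((u ^ d) ^ m * (K ^ B) ^ m) ≡⟨ cong (λ t → 2 ^ (a * m) * (t * (K ^ B) ^ m)) (^-comm u d m) ⟩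
      2 ^ (a * m) * (U ^ d * (K ^ B) ^ m) ∎

-- Colour classes c ∈ Fin B carry s c ∈ {0,1} units
-- (edges), d units in total; a map f : Fin B → Fin K sends its units to
-- part f c.  Weighting f by 2^(number of units missing part i) and using
-- independence of the values f c, the maps sending at most t units to
-- part i number at most  2^t ((2K-1)/(2K))^d · K^B.

∏-two-values : ∀ {B} (s g : Fin B → ℕ) x y →
               (∀ c → (s c ≡ 0 × g c ≡ x) ⊎ (s c ≡ 1 × g c ≡ y)) →
               ∏ g * x ^ sum s ≡ y ^ sum s * x ^ B
∏-two-values {zero}  s g x y cases = refl
∏-two-values {suc B} s g x y cases
  with cases zero | ∏-two-values (s ∘ suc) (g ∘ suc) x y (cases ∘ suc)
... | inj₁ (s₀≡0 , g₀≡x) | ih rewrite s₀≡0 | g₀≡x =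
  trans (*-assoc x P _) (trans (cong (x *_) ih)
    (solve 3 (λ x A C → x :* (A :* C) := A :* (x :* C)) refl x (y ^ S) (x ^ B)))
  where
  P S : ℕ
  P = ∏ (g ∘ suc)
  S = sum (s ∘ suc)
... | inj₂ (s₀≡1 , g₀≡y) | ih rewrite s₀≡1 | g₀≡y =
  trans (solve 4 (λ y P x X → y :* P :* (x :* X) := x :* y :* (P :* X)) refl y P x (x ^ S))
    (trans (cong (x * y *_) ih) (solve 4 (λ y x A C → x :* y :* (A :* C) := y :* A :* (x :* C)) refl y x (y ^ S) (x ^ B)))
  where
  P S : ℕ
  P = ∏ (g ∘ suc)
  S = sum (s ∘ suc)

module Chernoff (k : ℕ) {B : ℕ} (i : Fin (suc k)) (s : Fin B → ℕ) (s≤1 : ∀ c → s c ≤ 1) where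
  K : ℕ
  K = suc k
  open MapSum K

  d : ℕ
  d = sum s

  hits misses : Map B → ℕ
  hits   f = ∑[ c < B ] (s c * ind (f c ≟ᵇ i))
  misses f = ∑[ c < B ] (s c * ind (not (f c ≟ᵇ i)))

  misses+hits : ∀ f → misses f + hits f ≡ d
  misses+hits f = begin
    misses f + hits f
      ≡⟨ sym (∑-distrib-+ {B} (λ c → s c * ind (not (f c ≟ᵇ i))) _) ⟩
    ∑[ c < B ] (s c * ind (not (f c ≟ᵇ i)) + s c * ind (f c ≟ᵇ i))
      ≡⟨ sum-cong-≗ {B} (λ c → trans (sym (*-distribˡ-+ (s c) _ _))
                                  (trans (cong (s c *_) (ind-not (f c ≟ᵇ i))) (*-identityʳ (s c)))) ⟩
    d ∎
    where open ≡-Reasoning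

  φ : Fin B → Fin K → ℕ
  φ c j = 2 ^ (s c * ind (not (j ≟ᵇ i)))

  weight : Map B → ℕ
  weight f = ∏ (λ c → φ c (f c))

  weight≡ : ∀ f → weight f ≡ 2 ^ misses f
  weight≡ f = ∏-pow 2 (λ c → s c * ind (not (f c ≟ᵇ i)))

  ∑φ : ∀ c → (s c ≡ 0 × ∑[ j < K ] φ c j ≡ K) ⊎ (s c ≡ 1 × ∑[ j < K ] φ c j ≡ 2 * k + 1)
  ∑φ c with s c | s≤1 c
  ... | zero  | _       = inj₁ (refl , trans (∑-const K 1) (*-identityʳ K))
  ... | suc _ | s≤s z≤n = inj₂ (refl , +-cancelʳ-≡ 2 _ _ (begin
    ∑[ j < K ] (2 ^ (1 * ind (not (j ≟ᵇ i)))) + 2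
      ≡⟨ cong (_+ 2) (sum-cong-≗ {K} (λ j → one-unit (j ≟ᵇ i))) ⟩
    ∑[ j < K ] (if j ≟ᵇ i then 1 else 2) + 2
      ≡⟨ ∑-override i 1 2 ⟩
    1 + K * 2
      ≡⟨ solve 1 (λ k → con 1 :+ (con 1 :+ k) :* con 2 := con 2 :* k :+ con 1 :+ con 2) refl k ⟩
    2 * k + 1 + 2 ∎))
    where
    open ≡-Reasoning
    one-unit : ∀ b → 2 ^ (1 * ind (not b)) ≡ (if b then 1 else 2)
    one-unit true  = refl
    one-unit false = refl

  ∑weight : ∑map B weight * K ^ d ≡ (2 * k + 1) ^ d * K ^ B
  ∑weight = trans (cong (_* K ^ d) (∑map-∏ B φ)) (∏-two-values s (λ c → ∑[ j < K ] φ c j) K (2 * k + 1) ∑φ)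

  low-≤-weight : ∀ t (low : Map B → Bool) → (∀ f → low f ≡ true → hits f ≤ t) →
                 ∀ f → 2 ^ d * ind (low f) ≤ 2 ^ t * weight f
  low-≤-weight t low few f with low f in eq
  ... | false = subst (_≤ 2 ^ t * weight f) (sym (*-zeroʳ (2 ^ d))) z≤n
  ... | true  = begin
    2 ^ d * 1                     ≡⟨ *-identityʳ _ ⟩
    2 ^ d                         ≡⟨ cong (2 ^_) (sym (misses+hits f)) ⟩
    2 ^ (misses f + hits f)       ≡⟨ ^-distribˡ-+-* 2 (misses f) (hits f) ⟩
    2 ^ misses f * 2 ^ hits f     ≤⟨ *-monoʳ-≤ (2 ^ misses f) (^-monoʳ-≤ 2 (few f eq)) ⟩
    2 ^ misses f * 2 ^ t          ≡⟨ *-comm (2 ^ misses f) (2 ^ t) ⟩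
    2 ^ t * 2 ^ misses f          ≡⟨ cong (2 ^ t *_) (sym (weight≡ f)) ⟩
    2 ^ t * weight f ∎
    where open ≤-Reasoning

  count-low : ∀ t (low : Map B → Bool) → (∀ f → low f ≡ true → hits f ≤ t) →
              ∑map B (ind ∘ low) * (2 ^ d * K ^ d) ≤ 2 ^ t * ((2 * k + 1) ^ d * K ^ B)
  count-low t low few = begin
    ∑map B (ind ∘ low) * (2 ^ d * K ^ d)
      ≡⟨ solve 3 (λ a b c → a :* (b :* c) := b :* a :* c) refl (∑map B (ind ∘ low)) (2 ^ d) (K ^ d) ⟩
    2 ^ d * ∑map B (ind ∘ low) * K ^ d
      ≡⟨ cong (_* K ^ d) (sym (∑map-*ˡ B (2 ^ d) (ind ∘ low))) ⟩
    ∑map B (λ f → 2 ^ d * ind (low f)) * K ^ d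
      ≤⟨ *-monoˡ-≤ (K ^ d) (∑map-mono B (low-≤-weight t low few)) ⟩
    ∑map B (λ f → 2 ^ t * weight f) * K ^ d
      ≡⟨ trans (cong (_* K ^ d) (∑map-*ˡ B (2 ^ t) weight)) (*-assoc (2 ^ t) _ _) ⟩
    2 ^ t * (∑map B weight * K ^ d)
      ≡⟨ cong (2 ^ t *_) ∑weight ⟩
    2 ^ t * ((2 * k + 1) ^ d * K ^ B) ∎
    where open ≤-Reasoning

∧-true : ∀ {a b} → a ∧ b ≡ true → a ≡ true × b ≡ true
∧-true {true} {true} _ = refl , refl

dec-true : ∀ {P : Set} (d : Dec P) → ⌊ d ⌋ ≡ true → P
dec-true (yes p) _ = p

dec-false : ∀ {P : Set} (d : Dec P) → ind ⌊ d ⌋ ≡ 0 → ¬ P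
dec-false (no ¬p) _ = ¬p

-- All colours are at
-- most M, so reducing them modulo B = M + 1 loses nothing; by properness
-- each vertex meets every colour class at most once.

max-over : ∀ {n} → (Fin n → ℕ) → ℕ
max-over = foldr _⊔_ 0

≤-max-over : ∀ {n} (h : Fin n → ℕ) i → h i ≤ max-over h
≤-max-over h zero    = m≤m⊔n _ _
≤-max-over h (suc i) = ≤-trans (≤-max-over (h ∘ suc) i) (m≤n⊔m (h zero) _)

module ColourClasses {n} {G : SimpleGraph n} (c : ProperEdgeColouring G) where
  open SimpleGraph G using (adj; degree)
  open ProperEdgeColouring c using (col; proper)

  B : ℕ
  B = suc (max-over (λ u → max-over (col u)))

  class : ℕ → Fin B
  class x = x mod B

  col<B : ∀ u w → col u w < B
  col<B u w = s≤s (≤-trans (≤-max-over (col u) w) (≤-max-over (λ u → max-over (col u)) u))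

  toℕ-class : ∀ u w → toℕ (class (col u w)) ≡ col u w
  toℕ-class u w = trans (FP.toℕ-fromℕ< _) (m<n⇒m%n≡m (col<B u w))

  class-injective : ∀ v w w′ → adj v w ≡ true → adj v w′ ≡ true →
                    class (col v w) ≡ class (col v w′) → w ≡ w′
  class-injective v w w′ vw vw′ same with w F.≟ w′
  ... | yes w≡w′ = w≡w′
  ... | no  w≢w′ = ⊥-elim (proper v w w′ vw vw′ w≢w′
                     (trans (sym (toℕ-class v w)) (trans (cong toℕ same) (toℕ-class v w′))))

  units : Fin n → Fin B → ℕ
  units v x = ∑[ w < n ] ind (adj v w ∧ class (col v w) ≟ᵇ x)

  units≤1 : ∀ v x → units v x ≤ 1
  units≤1 v x = ∑-ind-unique (λ w → adj v w ∧ class (col v w) ≟ᵇ x) λ w w′ p p′ →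
    let (vw , wx) = ∧-true p; (vw′ , w′x) = ∧-true p′ in
    class-injective v w w′ vw vw′ (trans (≟ᵇ-true wx) (sym (≟ᵇ-true w′x)))

  ∑-by-class : ∀ v (h : Fin B → ℕ) →
               ∑[ w < n ] (ind (adj v w) * h (class (col v w))) ≡ ∑[ x < B ] (units v x * h x)
  ∑-by-class v h = sym (begin
    ∑[ x < B ] (units v x * h x)
      ≡⟨ sum-cong-≗ {B} (λ x → *-distribʳ-sum {n} (h x) (λ w → ind (adj v w ∧ class (col v w) ≟ᵇ x))) ⟩
    ∑[ x < B ] ∑[ w < n ] (ind (adj v w ∧ class (col v w) ≟ᵇ x) * h x)
      ≡⟨ ∑-comm {B} {n} (λ x w → ind (adj v w ∧ class (col v w) ≟ᵇ x) * h x) ⟩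
    ∑[ w < n ] ∑[ x < B ] (ind (adj v w ∧ class (col v w) ≟ᵇ x) * h x)
      ≡⟨ sum-cong-≗ {n} (λ w → sum-cong-≗ {B} (λ x → split w x)) ⟩
    ∑[ w < n ] ∑[ x < B ] (ind (class (col v w) ≟ᵇ x) * (ind (adj v w) * h x))
      ≡⟨ sum-cong-≗ {n} (λ w → ∑-point (class (col v w)) (λ x → ind (adj v w) * h x)) ⟩
    ∑[ w < n ] (ind (adj v w) * h (class (col v w))) ∎)
    where
    open ≡-Reasoning
    split : ∀ w x → ind (adj v w ∧ class (col v w) ≟ᵇ x) * h x
                    ≡ ind (class (col v w) ≟ᵇ x) * (ind (adj v w) * h x)
    split w x = trans (cong (_* h x) (ind-∧ (adj v w) _))
      (solve 3 (λ a b y → a :* b :* y := b :* (a :* y)) refl (ind (adj v w)) (ind (class (col v w) ≟ᵇ x)) (h x))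

  ∑units : ∀ v → sum (units v) ≡ degree v
  ∑units v = begin
    sum (units v)                               ≡⟨ sum-cong-≗ {B} (λ x → sym (*-identityʳ (units v x))) ⟩
    ∑[ x < B ] (units v x * 1)                  ≡⟨ sym (∑-by-class v (λ _ → 1)) ⟩
    ∑[ w < n ] (ind (adj v w) * 1)              ≡⟨ sum-cong-≗ {n} (λ w → *-identityʳ (ind (adj v w))) ⟩
    ∑[ w < n ] ind (adj v w)                    ≡⟨ sym (count-as-sum (adj v)) ⟩
    degree v ∎
    where open ≡-Reasoning

  module _ (k : ℕ) where
    open MapSum (suc k)

    partition : Map B → ℕ → Fin (suc k)
    partition f x = f (class x)

    partDegree≡hits : ∀ i f v → partDegree c (partition f) v i ≡ Chernoff.hits k i (units v) (units≤1 v) f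
    partDegree≡hits i f v = begin
      partDegree c (partition f) v i
        ≡⟨ count-as-sum (λ w → adj v w ∧ f (class (col v w)) ≟ᵇ i) ⟩
      ∑[ w < n ] ind (adj v w ∧ f (class (col v w)) ≟ᵇ i)
        ≡⟨ sum-cong-≗ {n} (λ w → ind-∧ (adj v w) _) ⟩
      ∑[ w < n ] (ind (adj v w) * ind (f (class (col v w)) ≟ᵇ i))
        ≡⟨ ∑-by-class v (λ x → ind (f x ≟ᵇ i)) ⟩
      ∑[ x < B ] (units v x * ind (f x ≟ᵇ i)) ∎
      where open ≡-Reasoning

union-bound : ∀ n K R (t : Fin n → Fin K → ℕ) → 0 < R → (∀ v i → n * K * t v i < R) →
              ∑[ v < n ] ∑[ i < K ] t v i < R
union-bound zero    K R t R>0 small = R>0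
union-bound (suc n) zero R t R>0 small =
  subst (_< R) (sym (∑-0 (suc n))) R>0
union-bound (suc n) (suc K) (suc R) t R>0 small =
  s≤s (*-cancelˡ-≤ N (begin
    N * ∑[ v < suc n ] ∑[ i < suc K ] t v i
      ≡⟨ *-distribˡ-sum {suc n} N (λ v → ∑[ i < suc K ] t v i) ⟩
    ∑[ v < suc n ] (N * ∑[ i < suc K ] t v i)
      ≡⟨ sum-cong-≗ {suc n} (λ v → *-distribˡ-sum {suc K} N (t v)) ⟩
    ∑[ v < suc n ] ∑[ i < suc K ] (N * t v i)
      ≤⟨ ∑-mono {suc n} (λ v → ∑-mono {suc K} (λ i → s≤s⁻¹ (small v i))) ⟩
    ∑[ v < suc n ] ∑[ i < suc K ] R
      ≡⟨ trans (sum-cong-≗ {suc n} (λ v → ∑-const (suc K) R)) (∑-const (suc n) (suc K * R)) ⟩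
    suc n * (suc K * R)
      ≡⟨ sym (*-assoc (suc n) (suc K) R) ⟩
    N * R ∎))
  where
  open ≤-Reasoning
  N : ℕ
  N = suc n * suc K

module BadMaps {n} {G : SimpleGraph n} (c : ProperEdgeColouring G) (k δ : ℕ) where
  open ColourClasses c
  open SimpleGraph G using (degree)
  K : ℕ
  K = suc k
  open MapSum K
  open TailEstimate k using (r; few-bad-maps)

  bad : Fin n → Fin K → Map B → Bool
  bad v i f = ⌊ 2 * K * partDegree c (partition k f) v i <? δ ⌋

  bad⇒few-hits : ∀ v i f → bad v i f ≡ true →
                 Chernoff.hits k i (units v) (units≤1 v) f ≤ δ / (2 * K)
  bad⇒few-hits v i f isBad =
    subst (λ h → h ≤ δ / (2 * K)) (partDegree≡hits k i f v)
      (subst (_≤ δ / (2 * K)) (m*n/n≡m X (2 * K))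
        (/-monoˡ-≤ (2 * K) (subst (_≤ δ) (*-comm (2 * K) X) (<⇒≤ (dec-true (_ <? δ) isBad)))))
    where
    X : ℕ
    X = partDegree c (partition k f) v i

  few-bad : ∀ v i → δ ≤ degree v → n * K * r ^ δ < suc r ^ δ →
            n * K * ∑map B (ind ∘ bad v i) < K ^ B
  few-bad v i δ≤deg hyp =
    few-bad-maps n δ (degree v) (δ / (2 * K)) B (∑map B (ind ∘ bad v i)) hyp
      (subst (λ d → ∑map B (ind ∘ bad v i) * (2 ^ d * K ^ d) ≤ 2 ^ (δ / (2 * K)) * ((2 * k + 1) ^ d * K ^ B))
             (∑units v)
             (Chernoff.count-low k i (units v) (units≤1 v) (δ / (2 * K)) (bad v i) (bad⇒few-hits v i)))
      (m/n*n≤m δ (2 * K)) δ≤deg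

lemma2p2 : (n : ℕ) (G : SimpleGraph n) (c : ProperEdgeColouring G) (δ k : ℕ) →
           1 ≤ k → SimpleGraph.MinDegree G δ → ExpHyp n k δ →
           Σ (ℕ → Fin k) λ part → ∀ v i → δ ≤ 2 * k * partDegree c part v i
lemma2p2 n G c δ (suc k) _ (minδ , _) hyp =
  partition k f , λ v i → ≮⇒≥ (dec-false (_ <? δ) (never-bad v i))
  where
  open ColourClasses c
  open BadMaps c k δ
  open MapSum K
  open TailEstimate k using (r)
  -- nK < exp(δ/8K) with 8K = r + 1
  exp-hyp : n * K * r ^ δ < suc r ^ δ
  exp-hyp = exp-bound r δ (n * K) (subst (0 <_) (+-comm 7 (8 * k)) (s≤s z≤n))
    (subst (λ q → LtExp (ratℕ (n * K) 1) (ratℕ δ q))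
           (solve 1 (λ k → con 8 :* (con 1 :+ k) := con 1 :+ (con 8 :* k :+ con 7)) refl k) hyp)
  total : Map B → ℕ
  total f = ∑[ v < n ] ∑[ i < K ] ind (bad v i f)
  total<all : ∑map B total < ∑map B (λ _ → 1)
  total<all = subst₂ _<_
    (sym (trans (∑map-∑ B (λ v f → ∑[ i < K ] ind (bad v i f)))
                (sum-cong-≗ {n} (λ v → ∑map-∑ B (λ i → ind ∘ bad v i)))))
    (sym (∑map-1 B))
    (union-bound n K (K ^ B) _ (m^n>0 K B) (λ v i → few-bad v i (minδ v) exp-hyp))
  witness : ∃ λ f → total f < 1
  witness = ∑map-<-witness B total (λ _ → 1) total<all
  f : Map B
  f = proj₁ witness
  never-bad : ∀ v i → ind (bad v i f) ≡ 0
  never-bad v i =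
    ∑≡0⇒≡0 (λ i → ind (bad v i f))
      (∑≡0⇒≡0 (λ v → ∑[ i < K ] ind (bad v i f)) (n<1⇒n≡0 (proj₂ witness)) v) i
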